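{- Let $p$ be a prime, let $w_1,w_2$ be positive integers, let $y_1,y_2\in\mathbb{Z}_p$, and let $n\ge0$ be an integer. Then \begin{align*} &\sum_{k=0}^{n}\binom{n}{k}B_{k}(w_{1}y_{1})B_{n-k}(w_{2}y_{2})w_{1}^{n-k}w_{2}^{k} =\sum_{k=0}^{n}\binom{n}{k}B_{k}(w_{2}y_{1})B_{n-k}(w_{1}y_{2})w_{2}^{n-k}w_{1}^{k}\\ &=\sum_{k+\ell+m=n}\binom{n}{k,\ell,m}B_{k}(y_{1})B_{\ell}(w_{2}y_{2})S_{m}(w_{1}-1)\,w_{2}^{k+m}w_{1}^{k+\ell-1}\\ &=\sum_{k+\ell+m=n}\binom{n}{k,\ell,m}B_{k}(w_{2}y_{1})B_{\ell}(y_{2})S_{m}(w_{1}-1)\,w_{2}^{\ell+m}w_{1}^{k+\ell-1}\\ &=\sum_{k+\ell+m=n}\binom{n}{k,\ell,m}B_{k}(y_{1})B_{\ell}(w_{1}y_{2})S_{m}(w_{2}-1)\,w_{1}^{k+m}w_{2}^{k+\ell-1}\\ &=\sum_{k+\ell+m=n}\binom{n}{k,\ell,m}B_{k}(w_{1}y_{1})B_{\ell}(y_{2})S_{m}(w_{2}-1)\,w_{1}^{\ell+m}w_{2}^{k+\ell-1}. \end{align*}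
   Context: $\mathbb{Z}_p$ denotes the ring of $p$-adic integers. The Bernoulli polynomials $B_n(x)$ are defined by $\frac{t}{e^t-1}e^{xt}=\sum_{n\ge0}B_n(x)\frac{t^n}{n!}$. For integers $k,N\ge0$, $S_k(N)=\sum_{i=0}^{N}i^k$, with the convention $0^0=1$ (so $S_0(N)=N+1$ and $S_k(0)=0$ for $k>0$). Sums $\sum_{k+\ell+m=n}$ run over all nonnegative integers $k,\ell,m$ with $k+\ell+m=n$, and $\binom{n}{k,\ell,m}=\frac{n!}{k!\,\ell!\,m!}$. -}

module Defs where

open import Level using (Level; _⊔_) renaming (suc to lsuc)
open import Data.Nat as ℕ using (ℕ; zero; suc; _∸_; NonZero)
open import Data.Nat.Properties using (m^n≢0; _!≢0; m*n≢0)
open import Data.Nat.DivMod using () renaming (_/_ to _div_)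
open import Data.Nat.Combinatorics using (_C_)
open import Data.Nat using (_!)
open import Data.Integer as ℤ using (ℤ; +_; -[1+_])
open import Data.Rational as ℚ using (ℚ; 1ℚ; 0ℚ)
open import Data.Rational.Properties using (+-*-commutativeRing)
open import Data.List using (List; []; _∷_; _++_; zipWith; upTo)
open import Algebra.Bundles using (CommutativeRing)
open import Algebra.Morphism.Structures using (module RingMorphisms)

-- ℚ-algebras: a commutative ring R together with a ring homomorphism
-- ι : ℚ → R.  (ℚ_p, which contains ℤ_p, is such an algebra.)

record QAlgebra (c ℓ : Level) : Set (lsuc (c ⊔ ℓ)) where
  field
    R : CommutativeRing c ℓ
  open CommutativeRing R public
  field
    ι     : ℚ → Carrier
    ι-hom : RingMorphisms.IsRingHomomorphism
              (CommutativeRing.rawRing +-*-commutativeRing) rawRing ι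

ℕ→ℚ : ℕ → ℚ
ℕ→ℚ n = (+ n) ℚ./ 1

sumℚ : List ℚ → ℚ
sumℚ []       = 0ℚ
sumℚ (x ∷ xs) = x ℚ.+ sumℚ xs

powℤ : (w : ℕ) → .{{NonZero w}} → ℤ → ℚ
powℤ w (+ j)     = ℕ→ℚ (w ℕ.^ j)
powℤ w -[1+ j ]  = ((+ 1) ℚ./ (w ℕ.^ suc j)) {{m^n≢0 w (suc j)}}

-- Bernoulli numbers B_0, B_1 = -1/2, B_2, ... (convention of t/(e^t-1)),
-- defined by B_0 = 1 and  Σ_{k=0}^{m} C(m+1,k) B_k = 0  for m ≥ 1.

nextBernoulli : ℕ → List ℚ → ℚ
nextBernoulli m bs =
  (-[1+ 0 ] ℚ./ suc m) ℚ.* sumℚ (zipWith (λ k b → ℕ→ℚ (suc m C k) ℚ.* b) (upTo m) bs)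

bernoulliList : ℕ → List ℚ
bernoulliList zero    = 1ℚ ∷ []
bernoulliList (suc n) = bernoulliList n ++ (nextBernoulli (suc n) (bernoulliList n) ∷ [])

lastOr : ℚ → List ℚ → ℚ
lastOr d []       = d
lastOr d (x ∷ xs) = lastOr x xs

bernoulliNumber : ℕ → ℚ
bernoulliNumber n = lastOr 0ℚ (bernoulliList n)

-- S_k(N) = Σ_{i=0}^{N} i^k  (with 0^0 = 1, as ℕ._^_ gives)

sumℕTo : ℕ → (ℕ → ℕ) → ℕ
sumℕTo zero    f = f 0
sumℕTo (suc N) f = sumℕTo N f ℕ.+ f (suc N)

S : ℕ → ℕ → ℕ
S k N = sumℕTo N (λ i → i ℕ.^ k)

multinomial : ℕ → ℕ → ℕ → ℕ
multinomial k l m =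
  ((k ℕ.+ l ℕ.+ m) !) div (k ! ℕ.* l ! ℕ.* m !)
  where instance _ = m*n≢0 (k ! ℕ.* l !) (m !) {{m*n≢0 (k !) (l !) {{k !≢0}} {{l !≢0}}}} {{m !≢0}}

module Over {c ℓ} (A : QAlgebra c ℓ) where
  open QAlgebra A

  sumTo : ℕ → (ℕ → Carrier) → Carrier
  sumTo zero    f = f 0
  sumTo (suc n) f = sumTo n f + f (suc n)

  pow : Carrier → ℕ → Carrier
  pow x zero    = 1#
  pow x (suc n) = x * pow x n

  nat : ℕ → Carrier
  nat n = ι (ℕ→ℚ n)

  B : ℕ → Carrier → Carrier
  B n x = sumTo n (λ k → nat (n C k) * ι (bernoulliNumber k) * pow x (n ∸ k))

  sumTriple : ℕ → (ℕ → ℕ → ℕ → Carrier) → Carrier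
  sumTriple n f = sumTo n (λ k → sumTo (n ∸ k) (λ l → f k l (n ∸ k ∸ l)))

-- Read a sequence a as the exponential generating function Σ aₙ tⁿ/n!. Then the binomial
-- convolution _⋆_ is the product of series, twist u is the substitution t ↦ ut, and the
-- Bernoulli polynomials are the coefficients of β ⋆ exp x = t e^{xt}/(eᵗ − 1). Because
-- β ⋆ (eᵗ − 1) = t and multiplication by eᵗ − 1 is injective, the power sums S_m(w − 1),
-- whose series is (e^{wt} − 1)/(eᵗ − 1), satisfy Raabe's multiplication formula
-- (twist w β) ⋆ S = w β. With it the factor w^{-1} in each triple sum cancels, and all six
-- sums become coefficients of  w₂t e^{w₁w₂y₁t}/(e^{w₂t} − 1) · w₁t e^{w₁w₂y₂t}/(e^{w₁t} − 1),
-- and rearranging its four factors exchanges w₁ and w₂.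

module Submission where

open import Defs
open import Level using (Level)
open import Data.Nat using (ℕ; NonZero; _∸_) renaming (_+_ to _+ℕ_)
open import Data.Nat.Combinatorics using (_C_)
open import Data.Nat.Primality using (Prime)
open import Data.Integer using (_⊖_)
open import Data.Product using (_×_; _,_)
open import Data.Empty using (⊥-elim)
open import Data.Nat using (zero; suc)
import Data.Nat as ℕ
import Relation.Binary.PropositionalEquality as ≡

module BinomialCoefficients where
  open import Data.Nat using (_+_; _*_; _!)
  open import Data.Nat.Properties
    using (+-comm; +-assoc; +-identityʳ; +-suc; *-identityˡ; *-identityʳ; *-distribʳ-+; *-cancelʳ-≡; m*n≢0; _!≢0; n≤1+n; m+n∸n≡m)
  open import Data.Nat.Combinatorics using (nCn≡1; nCk+nC[k+1]≡[n+1]C[k+1]; nCk≡nC[n∸k]; nC1≡n)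
  open import Data.Nat.DivMod using (_/_; m*n/n≡m)
  open import Data.Nat.Tactic.RingSolver using (solve-∀)
  open import Relation.Binary.PropositionalEquality
  open ≡-Reasoning

  -- binom i j = (i + j) C i, defined by Pascal's rule so that the symmetry in i and j is evident.
  binom : ℕ → ℕ → ℕ
  binom zero    j       = 1
  binom (suc i) zero    = 1
  binom (suc i) (suc j) = binom i (suc j) + binom (suc i) j

  binom-comm : ∀ i j → binom i j ≡ binom j i
  binom-comm zero    zero    = refl
  binom-comm zero    (suc j) = refl
  binom-comm (suc i) zero    = refl
  binom-comm (suc i) (suc j) =
    trans (cong₂ _+_ (binom-comm i (suc j)) (binom-comm (suc i) j))
          (+-comm (binom (suc j) i) (binom j (suc i)))

  C≡binom : ∀ i j → (i + j) C i ≡ binom i j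
  C≡binom zero    j       = refl
  C≡binom (suc i) zero    = trans (cong (_C suc i) (+-identityʳ (suc i))) (nCn≡1 (suc i))
  C≡binom (suc i) (suc j) = begin
    suc (i + suc j) C suc i                 ≡⟨ nCk+nC[k+1]≡[n+1]C[k+1] (i + suc j) i ⟨
    (i + suc j) C i + (i + suc j) C suc i   ≡⟨ cong ((i + suc j) C i +_) (cong (_C suc i) (+-suc i j)) ⟩
    (i + suc j) C i + (suc i + j) C suc i   ≡⟨ cong₂ _+_ (C≡binom i (suc j)) (C≡binom (suc i) j) ⟩
    binom i (suc j) + binom (suc i) j       ∎

  C≡binom′ : ∀ k j {n} → k + j ≡ n → n C k ≡ binom k j
  C≡binom′ k j refl = C≡binom k j

  binom-! : ∀ i j → binom i j * (i ! * j !) ≡ (i + j) !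
  binom-! zero    j       = trans (*-identityˡ _) (*-identityˡ _)
  binom-! (suc i) zero    =
    trans (*-identityˡ _) (trans (*-identityʳ _) (cong _! (sym (+-identityʳ (suc i)))))
  binom-! (suc i) (suc j) = begin
    (binom i (suc j) + binom (suc i) j) * ((suc i * i !) * (suc j * j !))
      ≡⟨ pascal-step i j (binom i (suc j)) (binom (suc i) j) (i !) (j !) ⟩
    suc i * (binom i (suc j) * (i ! * (suc j * j !))) + suc j * (binom (suc i) j * ((suc i * i !) * j !))
      ≡⟨ cong₂ (λ u v → suc i * u + suc j * v) (binom-! i (suc j))
               (trans (binom-! (suc i) j) (cong _! (sym (+-suc i j)))) ⟩
    suc i * (i + suc j) ! + suc j * (i + suc j) !
      ≡⟨ *-distribʳ-+ ((i + suc j) !) (suc i) (suc j) ⟨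
    (suc i + suc j) * (i + suc j) !
      ∎
    where
    pascal-step : ∀ i j X Y a b → (X + Y) * ((suc i * a) * (suc j * b))
                                  ≡ suc i * (X * (a * (suc j * b))) + suc j * (Y * ((suc i * a) * b))
    pascal-step = solve-∀

  factorials≢0 : ∀ i j k → NonZero (i ! * j ! * k !)
  factorials≢0 i j k = m*n≢0 (i ! * j !) (k !) {{m*n≢0 (i !) (j !) {{i !≢0}} {{j !≢0}}}} {{k !≢0}}

  binom-split-! : ∀ i j k → binom i (j + k) * binom j k * (i ! * j ! * k !) ≡ (i + j + k) !
  binom-split-! i j k = begin
    binom i (j + k) * binom j k * (i ! * j ! * k !)   ≡⟨ regroup (binom i (j + k)) (binom j k) (i !) (j !) (k !) ⟩
    binom i (j + k) * (i ! * (binom j k * (j ! * k !))) ≡⟨ cong (λ z → binom i (j + k) * (i ! * z)) (binom-! j k) ⟩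
    binom i (j + k) * (i ! * (j + k) !)              ≡⟨ binom-! i (j + k) ⟩
    (i + (j + k)) !                                  ≡⟨ cong _! (+-assoc i j k) ⟨
    (i + j + k) !                                    ∎
    where
    regroup : ∀ X Y a b c → X * Y * (a * b * c) ≡ X * (a * (Y * (b * c)))
    regroup = solve-∀

  binom-merge-! : ∀ i j k → binom (i + j) k * binom i j * (i ! * j ! * k !) ≡ (i + j + k) !
  binom-merge-! i j k = begin
    binom (i + j) k * binom i j * (i ! * j ! * k !)   ≡⟨ regroup (binom (i + j) k) (binom i j) (i !) (j !) (k !) ⟩
    binom (i + j) k * (binom i j * (i ! * j !) * k !) ≡⟨ cong (λ z → binom (i + j) k * (z * k !)) (binom-! i j) ⟩
    binom (i + j) k * ((i + j) ! * k !)              ≡⟨ binom-! (i + j) k ⟩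
    (i + j + k) !                                    ∎
    where
    regroup : ∀ X Y a b c → X * Y * (a * b * c) ≡ X * (Y * (a * b) * c)
    regroup = solve-∀

  multinomial≡binom*binom : ∀ i j k → multinomial i j k ≡ binom i (j + k) * binom j k
  multinomial≡binom*binom i j k =
    trans (cong (λ z → (z / (i ! * j ! * k !)) {{factorials≢0 i j k}}) (sym (binom-split-! i j k)))
          (m*n/n≡m _ (i ! * j ! * k !) {{factorials≢0 i j k}})

  binom-assoc : ∀ i j k → binom (i + j) k * binom i j ≡ binom i (j + k) * binom j k
  binom-assoc i j k = *-cancelʳ-≡ _ _ (i ! * j ! * k !) {{factorials≢0 i j k}}
    (trans (binom-merge-! i j k) (sym (binom-split-! i j k)))

  suc-C : ∀ n → suc n C n ≡ suc n
  suc-C n = trans (nCk≡nC[n∸k] (n≤1+n n)) (trans (cong (suc n C_) (m+n∸n≡m 1 n)) (nC1≡n (suc n)))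

module NatToRational where
  open import Data.Integer using (+_)
  import Data.Integer as ℤ
  import Data.Integer.Properties as ℤ
  open import Data.Rational using (mkℚ; 1ℚ)
  import Data.Rational as ℚ
  import Data.Rational.Properties as ℚ
  open import Data.Nat.Coprimality using (1-coprimeTo) renaming (sym to coprime-sym)
  open import Relation.Binary.PropositionalEquality

  ℕ→ℚ≡mkℚ : ∀ n → ℕ→ℚ n ≡ mkℚ (+ n) 0 (coprime-sym (1-coprimeTo n))
  ℕ→ℚ≡mkℚ n = ℚ.normalize-coprime (coprime-sym (1-coprimeTo n))

  ℕ→ℚ-+ : ∀ m n → ℕ→ℚ (m ℕ.+ n) ≡ ℕ→ℚ m ℚ.+ ℕ→ℚ n
  ℕ→ℚ-+ m n rewrite ℕ→ℚ≡mkℚ m | ℕ→ℚ≡mkℚ n =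
    cong (λ z → z ℚ./ 1) (sym (cong₂ ℤ._+_ (ℤ.*-identityʳ (+ m)) (ℤ.*-identityʳ (+ n))))

  ℕ→ℚ-* : ∀ m n → ℕ→ℚ (m ℕ.* n) ≡ ℕ→ℚ m ℚ.* ℕ→ℚ n
  ℕ→ℚ-* m n rewrite ℕ→ℚ≡mkℚ m | ℕ→ℚ≡mkℚ n = cong (λ z → z ℚ./ 1) (ℤ.pos-* m n)

  1/n*n≡1 : ∀ n .{{_ : ℕ.NonZero n}} → (+ 1 ℚ./ n) ℚ.* ℕ→ℚ n ≡ 1ℚ
  1/n*n≡1 (suc n) rewrite ℕ→ℚ≡mkℚ (suc n) | ℚ.normalize-coprime {1} {n} (1-coprimeTo (suc n)) =
    ℚ.*-inverseˡ (mkℚ (+ suc n) 0 (coprime-sym (1-coprimeTo (suc n))))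

module BernoulliNumbers where
  open import Data.Integer using (-[1+_])
  open import Data.Rational using (ℚ; 0ℚ)
  import Data.Rational as ℚ
  open import Data.List using ([]; _∷_; _++_; [_]; map; zipWith; upTo)
  import Data.List.Properties as List
  open import Relation.Binary.PropositionalEquality hiding ([_])

  lastOr-∷ʳ : ∀ d xs x → lastOr d (xs ++ [ x ]) ≡ x
  lastOr-∷ʳ d []       x = refl
  lastOr-∷ʳ d (y ∷ xs) x = lastOr-∷ʳ y xs x

  bernoulliList≡map : ∀ n → bernoulliList n ≡ map bernoulliNumber (upTo (suc n))
  bernoulliList≡map zero    = refl
  bernoulliList≡map (suc n) = begin
    bernoulliList n ++ [ nextBernoulli (suc n) (bernoulliList n) ]
      ≡⟨ cong₂ (λ bs b → bs ++ [ b ]) (bernoulliList≡map n) (sym (lastOr-∷ʳ 0ℚ (bernoulliList n) _)) ⟩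
    map bernoulliNumber (upTo (suc n)) ++ [ bernoulliNumber (suc n) ]
      ≡⟨ List.map-++ bernoulliNumber (upTo (suc n)) [ suc n ] ⟨
    map bernoulliNumber (upTo (suc n) ++ [ suc n ])
      ≡⟨ cong (map bernoulliNumber) (List.upTo-∷ʳ (suc n)) ⟩
    map bernoulliNumber (upTo (suc (suc n)))
      ∎
    where open ≡-Reasoning

  zipWith-map-diagonal : ∀ {A B C : Set} (f : A → B → C) (g : A → B) xs →
                         zipWith f xs (map g xs) ≡ map (λ x → f x (g x)) xs
  zipWith-map-diagonal f g []       = refl
  zipWith-map-diagonal f g (x ∷ xs) = cong (f x (g x) ∷_) (zipWith-map-diagonal f g xs)

  bernoulliNumber-suc : ∀ m → bernoulliNumber (suc m) ≡
    (-[1+ 0 ] ℚ./ suc (suc m)) ℚ.* sumℚ (map (λ k → ℕ→ℚ (suc (suc m) C k) ℚ.* bernoulliNumber k) (upTo (suc m)))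
  bernoulliNumber-suc m = begin
    bernoulliNumber (suc m)
      ≡⟨ lastOr-∷ʳ 0ℚ (bernoulliList m) _ ⟩
    nextBernoulli (suc m) (bernoulliList m)
      ≡⟨ cong (λ bs → (-[1+ 0 ] ℚ./ suc (suc m)) ℚ.* sumℚ (zipWith weigh (upTo (suc m)) bs)) (bernoulliList≡map m) ⟩
    (-[1+ 0 ] ℚ./ suc (suc m)) ℚ.* sumℚ (zipWith weigh (upTo (suc m)) (map bernoulliNumber (upTo (suc m))))
      ≡⟨ cong (λ xs → (-[1+ 0 ] ℚ./ suc (suc m)) ℚ.* sumℚ xs) (zipWith-map-diagonal weigh bernoulliNumber (upTo (suc m))) ⟩
    (-[1+ 0 ] ℚ./ suc (suc m)) ℚ.* sumℚ (map (λ k → weigh k (bernoulliNumber k)) (upTo (suc m)))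
      ∎
    where
    open ≡-Reasoning
    weigh : ℕ → ℚ → ℚ
    weigh k b = ℕ→ℚ (suc (suc m) C k) ℚ.* b

module ExponentialGeneratingFunctions {c ℓ} (A : QAlgebra c ℓ) where
  open import Data.Nat using (_≤_)
  import Data.Nat.Properties as ℕ
  open import Data.Integer using (+_; -[1+_])
  open import Data.Rational using (ℚ)
  import Data.Rational as ℚ
  open import Data.Rational.Properties using (+-*-commutativeRing)
  open import Data.List using ([]; _∷_; _++_; [_]; map; upTo)
  import Data.List.Properties as List
  open import Data.Sum using (inj₁; inj₂)
  open import Algebra.Bundles using (CommutativeRing; CommutativeSemigroup)
  open import Algebra.Morphism.Structures using (module RingMorphisms)
  open import Relation.Binary.Bundles using (Setoid)
  open ≡ using (_≡_)
  open BinomialCoefficients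
  open NatToRational
  open BernoulliNumbers

  open QAlgebra A
  open Over A
  open RingMorphisms (CommutativeRing.rawRing +-*-commutativeRing) rawRing using (module IsRingHomomorphism)
  open IsRingHomomorphism ι-hom using (+-homo; *-homo; -‿homo; 0#-homo; 1#-homo)
  open import Algebra.Properties.Ring ring using (-‿distribˡ-*; -‿distribʳ-*)
  open import Algebra.Properties.Group +-group using (∙-cancelˡ)
  open import Algebra.Properties.CommutativeSemigroup *-commutativeSemigroup using ()
    renaming (x∙yz≈y∙xz to x*yz≈y*xz; interchange to *-interchange)
  open import Algebra.Solver.Ring.NaturalCoefficients.Default commutativeSemiring
  import Relation.Binary.Reasoning.Setoid as SetoidReasoning
  open SetoidReasoning setoid

  nat-+ : ∀ m n → nat (m +ℕ n) ≈ nat m + nat n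
  nat-+ m n = trans (reflexive (≡.cong ι (ℕ→ℚ-+ m n))) (+-homo _ _)

  nat-* : ∀ m n → nat (m ℕ.* n) ≈ nat m * nat n
  nat-* m n = trans (reflexive (≡.cong ι (ℕ→ℚ-* m n))) (*-homo _ _)

  nat-^ : ∀ m k → nat (m ℕ.^ k) ≈ pow (nat m) k
  nat-^ m zero    = 1#-homo
  nat-^ m (suc k) = trans (nat-* m (m ℕ.^ k)) (*-cong refl (nat-^ m k))

  nat-suc : ∀ n → nat (suc n) ≈ nat n + 1#
  nat-suc n = trans (reflexive (≡.cong nat (ℕ.+-comm 1 n))) (trans (nat-+ n 1) (+-cong refl 1#-homo))

  1/n*n≈1 : ∀ n .{{_ : ℕ.NonZero n}} → ι (+ 1 ℚ./ n) * nat n ≈ 1#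
  1/n*n≈1 n = trans (sym (*-homo _ _)) (trans (reflexive (≡.cong ι (1/n*n≡1 n))) 1#-homo)

  nat-suc-cancelˡ : ∀ n {x y} → nat (suc n) * x ≈ nat (suc n) * y → x ≈ y
  nat-suc-cancelˡ n {x} {y} eq = begin
    x                                      ≈⟨ cancel x ⟨
    ι (+ 1 ℚ./ suc n) * (nat (suc n) * x)  ≈⟨ *-cong refl eq ⟩
    ι (+ 1 ℚ./ suc n) * (nat (suc n) * y)  ≈⟨ cancel y ⟩
    y                                      ∎
    where
    cancel : ∀ z → ι (+ 1 ℚ./ suc n) * (nat (suc n) * z) ≈ z
    cancel z = trans (sym (*-assoc _ _ _)) (trans (*-cong (1/n*n≈1 (suc n)) refl) (*-identityˡ z))

  pow-cong : ∀ {x y} n → x ≈ y → pow x n ≈ pow y n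
  pow-cong zero    x≈y = refl
  pow-cong (suc n) x≈y = *-cong x≈y (pow-cong n x≈y)

  pow-+ : ∀ x i j → pow x (i +ℕ j) ≈ pow x i * pow x j
  pow-+ x zero    j = sym (*-identityˡ _)
  pow-+ x (suc i) j = trans (*-cong refl (pow-+ x i j)) (sym (*-assoc _ _ _))

  pow-* : ∀ x y n → pow (x * y) n ≈ pow x n * pow y n
  pow-* x y zero    = sym (*-identityˡ _)
  pow-* x y (suc n) = trans (*-cong refl (pow-* x y n)) (*-interchange x y (pow x n) (pow y n))

  pow-1# : ∀ n → pow 1# n ≈ 1#
  pow-1# zero    = refl
  pow-1# (suc n) = trans (*-identityˡ _) (pow-1# n)

  sumTo-cong : ∀ n {f g : ℕ → Carrier} → (∀ k → k ≤ n → f k ≈ g k) → sumTo n f ≈ sumTo n g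
  sumTo-cong zero    f≈g = f≈g 0 ℕ.z≤n
  sumTo-cong (suc n) f≈g = +-cong (sumTo-cong n (λ k k≤n → f≈g k (ℕ.m≤n⇒m≤1+n k≤n))) (f≈g (suc n) ℕ.≤-refl)

  sumTo-front : ∀ n f → sumTo (suc n) f ≈ f 0 + sumTo n (λ k → f (suc k))
  sumTo-front zero    f = refl
  sumTo-front (suc n) f = trans (+-cong (sumTo-front n f) refl) (+-assoc _ _ _)

  sumTo-telescope : ∀ N {f g : ℕ → Carrier} → (∀ i → f i + g i ≈ g (suc i)) → sumTo N f + g 0 ≈ g (suc N)
  sumTo-telescope zero    step = step 0
  sumTo-telescope (suc N) {f} {g} step = begin
    (sumTo N f + f (suc N)) + g 0  ≈⟨ solve 3 (λ s x y → (s :+ x) :+ y := x :+ (s :+ y)) refl (sumTo N f) (f (suc N)) (g 0) ⟩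
    f (suc N) + (sumTo N f + g 0)  ≈⟨ +-cong refl (sumTo-telescope N step) ⟩
    f (suc N) + g (suc N)          ≈⟨ step (suc N) ⟩
    g (suc (suc N))                ∎

  Σ-antidiag : ℕ → (ℕ → ℕ → Carrier) → Carrier
  Σ-antidiag zero    f = f 0 0
  Σ-antidiag (suc n) f = f 0 (suc n) + Σ-antidiag n (λ i j → f (suc i) j)

  sumTo≈Σ-antidiag : ∀ n f → sumTo n (λ k → f k (n ∸ k)) ≈ Σ-antidiag n f
  sumTo≈Σ-antidiag zero    f = refl
  sumTo≈Σ-antidiag (suc n) f =
    trans (sumTo-front n (λ k → f k (suc n ∸ k))) (+-cong refl (sumTo≈Σ-antidiag n (λ i j → f (suc i) j)))

  Σ-antidiag-cong : ∀ n {f g} → (∀ i j → i +ℕ j ≡ n → f i j ≈ g i j) → Σ-antidiag n f ≈ Σ-antidiag n g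
  Σ-antidiag-cong zero    f≈g = f≈g 0 0 ≡.refl
  Σ-antidiag-cong (suc n) f≈g =
    +-cong (f≈g 0 (suc n) ≡.refl) (Σ-antidiag-cong n (λ i j i+j≡n → f≈g (suc i) j (≡.cong suc i+j≡n)))

  Σ-antidiag-snoc : ∀ n f → Σ-antidiag (suc n) f ≈ Σ-antidiag n (λ i j → f i (suc j)) + f (suc n) 0
  Σ-antidiag-snoc zero    f = refl
  Σ-antidiag-snoc (suc n) f =
    trans (+-cong refl (Σ-antidiag-snoc n (λ i j → f (suc i) j))) (sym (+-assoc _ _ _))

  Σ-antidiag-swap : ∀ n f → Σ-antidiag n f ≈ Σ-antidiag n (λ i j → f j i)
  Σ-antidiag-swap zero    f = refl
  Σ-antidiag-swap (suc n) f = begin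
    f 0 (suc n) + Σ-antidiag n (λ i j → f (suc i) j)   ≈⟨ +-cong refl (Σ-antidiag-swap n (λ i j → f (suc i) j)) ⟩
    f 0 (suc n) + Σ-antidiag n (λ i j → f (suc j) i)   ≈⟨ +-comm _ _ ⟩
    Σ-antidiag n (λ i j → f (suc j) i) + f 0 (suc n)   ≈⟨ Σ-antidiag-snoc n (λ i j → f j i) ⟨
    Σ-antidiag (suc n) (λ i j → f j i)                 ∎

  Σ-antidiag-+ : ∀ n f g → Σ-antidiag n (λ i j → f i j + g i j) ≈ Σ-antidiag n f + Σ-antidiag n g
  Σ-antidiag-+ zero    f g = refl
  Σ-antidiag-+ (suc n) f g = trans (+-cong refl (Σ-antidiag-+ n _ _))
    (solve 4 (λ a b c d → (a :+ b) :+ (c :+ d) := (a :+ c) :+ (b :+ d)) refl _ _ _ _)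

  *-Σ-antidiag : ∀ n s f → s * Σ-antidiag n f ≈ Σ-antidiag n (λ i j → s * f i j)
  *-Σ-antidiag zero    s f = refl
  *-Σ-antidiag (suc n) s f = trans (distribˡ _ _ _) (+-cong refl (*-Σ-antidiag n s _))

  Σ-antidiag-zero : ∀ n → Σ-antidiag n (λ _ _ → 0#) ≈ 0#
  Σ-antidiag-zero zero    = refl
  Σ-antidiag-zero (suc n) = trans (+-identityˡ _) (Σ-antidiag-zero n)

  Σ-antidiag-interchange : ∀ n (g : ℕ → ℕ → ℕ → Carrier) →
    Σ-antidiag n (λ r k → Σ-antidiag r (λ i j → g i j k)) ≈ Σ-antidiag n (λ i r → Σ-antidiag r (λ j k → g i j k))
  Σ-antidiag-interchange zero    g = refl
  Σ-antidiag-interchange (suc n) g = begin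
    g 0 0 (suc n) + Σ-antidiag n (λ r k → g 0 (suc r) k + Σ-antidiag r (λ i j → g (suc i) j k))
      ≈⟨ +-cong refl (Σ-antidiag-+ n _ _) ⟩
    g 0 0 (suc n) + (Σ-antidiag n (λ r k → g 0 (suc r) k) + Σ-antidiag n (λ r k → Σ-antidiag r (λ i j → g (suc i) j k)))
      ≈⟨ +-cong refl (+-cong refl (Σ-antidiag-interchange n (λ i j k → g (suc i) j k))) ⟩
    g 0 0 (suc n) + (Σ-antidiag n (λ r k → g 0 (suc r) k) + Σ-antidiag n (λ i r → Σ-antidiag r (λ j k → g (suc i) j k)))
      ≈⟨ +-assoc _ _ _ ⟨
    (g 0 0 (suc n) + Σ-antidiag n (λ r k → g 0 (suc r) k)) + Σ-antidiag n (λ i r → Σ-antidiag r (λ j k → g (suc i) j k))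
      ∎

  -- Binomial convolution

  Seq : Set c
  Seq = ℕ → Carrier

  infix 4 _≐_
  _≐_ : Seq → Seq → Set ℓ
  a ≐ b = ∀ n → a n ≈ b n

  ≐-setoid : Setoid c ℓ
  ≐-setoid = record
    { Carrier       = Seq
    ; _≈_           = _≐_
    ; isEquivalence = record
      { refl  = λ n → refl
      ; sym   = λ a≐b n → sym (a≐b n)
      ; trans = λ a≐b b≐c n → trans (a≐b n) (b≐c n)
      }
    }

  module ≐ = Setoid ≐-setoid

  infixl 7 _⋆_
  _⋆_ : Seq → Seq → Seq
  (a ⋆ b) n = Σ-antidiag n (λ i j → nat (binom i j) * (a i * b j))

  ⋆-cong : ∀ {a a′ b b′} → a ≐ a′ → b ≐ b′ → a ⋆ b ≐ a′ ⋆ b′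
  ⋆-cong a≐a′ b≐b′ n = Σ-antidiag-cong n (λ i j _ → *-cong refl (*-cong (a≐a′ i) (b≐b′ j)))

  ⋆-comm : ∀ a b → a ⋆ b ≐ b ⋆ a
  ⋆-comm a b n = trans (Σ-antidiag-swap n _)
    (Σ-antidiag-cong n (λ i j _ → *-cong (reflexive (≡.cong nat (binom-comm j i))) (*-comm _ _)))

  ⋆-⋆-expand : ∀ a b d n → (a ⋆ (b ⋆ d)) n ≈
    Σ-antidiag n (λ i r → Σ-antidiag r (λ j k → nat (binom i (j +ℕ k) ℕ.* binom j k) * (a i * (b j * d k))))
  ⋆-⋆-expand a b d n = Σ-antidiag-cong n (λ i r _ → begin
    nat (binom i r) * (a i * Σ-antidiag r (λ j k → nat (binom j k) * (b j * d k)))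
      ≈⟨ *-cong refl (*-Σ-antidiag r (a i) _) ⟩
    nat (binom i r) * Σ-antidiag r (λ j k → a i * (nat (binom j k) * (b j * d k)))
      ≈⟨ *-Σ-antidiag r _ _ ⟩
    Σ-antidiag r (λ j k → nat (binom i r) * (a i * (nat (binom j k) * (b j * d k))))
      ≈⟨ Σ-antidiag-cong r (λ j k j+k≡r → begin
           nat (binom i r) * (a i * (nat (binom j k) * (b j * d k)))
             ≈⟨ *-cong (reflexive (≡.cong (λ r → nat (binom i r)) (≡.sym j+k≡r))) refl ⟩
           nat (binom i (j +ℕ k)) * (a i * (nat (binom j k) * (b j * d k)))
             ≈⟨ solve 5 (λ X Y a b d → X :* (a :* (Y :* (b :* d))) := (X :* Y) :* (a :* (b :* d))) refl _ _ _ _ _ ⟩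
           nat (binom i (j +ℕ k)) * nat (binom j k) * (a i * (b j * d k))
             ≈⟨ *-cong (nat-* (binom i (j +ℕ k)) (binom j k)) refl ⟨
           nat (binom i (j +ℕ k) ℕ.* binom j k) * (a i * (b j * d k))
             ∎) ⟩
    Σ-antidiag r (λ j k → nat (binom i (j +ℕ k) ℕ.* binom j k) * (a i * (b j * d k)))
      ∎)

  ⋆-assoc : ∀ a b d → (a ⋆ b) ⋆ d ≐ a ⋆ (b ⋆ d)
  ⋆-assoc a b d n = begin
    Σ-antidiag n (λ r k → nat (binom r k) * (Σ-antidiag r (λ i j → nat (binom i j) * (a i * b j)) * d k))
      ≈⟨ Σ-antidiag-cong n (λ r k _ → expand r k) ⟩
    Σ-antidiag n (λ r k → Σ-antidiag r (λ i j → nat (binom i (j +ℕ k) ℕ.* binom j k) * (a i * (b j * d k))))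
      ≈⟨ Σ-antidiag-interchange n (λ i j k → nat (binom i (j +ℕ k) ℕ.* binom j k) * (a i * (b j * d k))) ⟩
    Σ-antidiag n (λ i r → Σ-antidiag r (λ j k → nat (binom i (j +ℕ k) ℕ.* binom j k) * (a i * (b j * d k))))
      ≈⟨ ⋆-⋆-expand a b d n ⟨
    (a ⋆ (b ⋆ d)) n
      ∎
    where
    expand : ∀ r k → nat (binom r k) * (Σ-antidiag r (λ i j → nat (binom i j) * (a i * b j)) * d k) ≈
                     Σ-antidiag r (λ i j → nat (binom i (j +ℕ k) ℕ.* binom j k) * (a i * (b j * d k)))
    expand r k = begin
      nat (binom r k) * (Σ-antidiag r (λ i j → nat (binom i j) * (a i * b j)) * d k)
        ≈⟨ *-cong refl (*-comm _ _) ⟩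
      nat (binom r k) * (d k * Σ-antidiag r (λ i j → nat (binom i j) * (a i * b j)))
        ≈⟨ *-cong refl (*-Σ-antidiag r (d k) _) ⟩
      nat (binom r k) * Σ-antidiag r (λ i j → d k * (nat (binom i j) * (a i * b j)))
        ≈⟨ *-Σ-antidiag r _ _ ⟩
      Σ-antidiag r (λ i j → nat (binom r k) * (d k * (nat (binom i j) * (a i * b j))))
        ≈⟨ Σ-antidiag-cong r (λ i j i+j≡r → begin
             nat (binom r k) * (d k * (nat (binom i j) * (a i * b j)))
               ≈⟨ *-cong (reflexive (≡.cong (λ r → nat (binom r k)) (≡.sym i+j≡r))) refl ⟩
             nat (binom (i +ℕ j) k) * (d k * (nat (binom i j) * (a i * b j)))
               ≈⟨ solve 5 (λ X Y d a b → X :* (d :* (Y :* (a :* b))) := (X :* Y) :* (a :* (b :* d))) refl _ _ _ _ _ ⟩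
             nat (binom (i +ℕ j) k) * nat (binom i j) * (a i * (b j * d k))
               ≈⟨ *-cong (nat-* (binom (i +ℕ j) k) (binom i j)) refl ⟨
             nat (binom (i +ℕ j) k ℕ.* binom i j) * (a i * (b j * d k))
               ≈⟨ *-cong (reflexive (≡.cong nat (binom-assoc i j k))) refl ⟩
             nat (binom i (j +ℕ k) ℕ.* binom j k) * (a i * (b j * d k))
               ∎) ⟩
      Σ-antidiag r (λ i j → nat (binom i (j +ℕ k) ℕ.* binom j k) * (a i * (b j * d k)))
        ∎

  ⋆-commutativeSemigroup : CommutativeSemigroup c ℓ
  ⋆-commutativeSemigroup = record
    { Carrier                = Seq
    ; _≈_                    = _≐_
    ; _∙_                    = _⋆_
    ; isCommutativeSemigroup = record
      { isSemigroup = record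
        { isMagma = record { isEquivalence = ≐.isEquivalence ; ∙-cong = ⋆-cong }
        ; assoc   = ⋆-assoc
        }
      ; comm        = ⋆-comm
      }
    }

  open import Algebra.Properties.CommutativeSemigroup ⋆-commutativeSemigroup
    using (interchange; xy∙z≈xz∙y; x∙yz≈xz∙y)

  infixr 8 _·_
  _·_ : Carrier → Seq → Seq
  (s · a) n = s * a n

  ·-cong : ∀ s {a b} → a ≐ b → s · a ≐ s · b
  ·-cong s a≐b n = *-cong refl (a≐b n)

  ⋆-·ˡ : ∀ s a b → (s · a) ⋆ b ≐ s · (a ⋆ b)
  ⋆-·ˡ s a b n = sym (trans (*-Σ-antidiag n s _) (Σ-antidiag-cong n (λ i j _ →
    solve 4 (λ s X a b → s :* (X :* (a :* b)) := X :* ((s :* a) :* b)) refl s (nat (binom i j)) (a i) (b j))))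

  ⋆-·ʳ : ∀ s a b → a ⋆ (s · b) ≐ s · (a ⋆ b)
  ⋆-·ʳ s a b = ≐.trans (⋆-comm a (s · b)) (≐.trans (⋆-·ˡ s b a) (·-cong s (⋆-comm b a)))

  infixl 6 _⊕_
  _⊕_ : Seq → Seq → Seq
  (a ⊕ b) n = a n + b n

  ⋆-distribʳ-⊕ : ∀ a a′ b → (a ⊕ a′) ⋆ b ≐ (a ⋆ b) ⊕ (a′ ⋆ b)
  ⋆-distribʳ-⊕ a a′ b n = trans (Σ-antidiag-cong n (λ i j _ →
    solve 4 (λ X a a′ b → X :* ((a :+ a′) :* b) := X :* (a :* b) :+ X :* (a′ :* b)) refl (nat (binom i j)) (a i) (a′ i) (b j)))
    (Σ-antidiag-+ n _ _)

  sumTo-⋆ : ∀ N (F : ℕ → Seq) b → (λ m → sumTo N (λ i → F i m)) ⋆ b ≐ (λ n → sumTo N (λ i → (F i ⋆ b) n))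
  sumTo-⋆ zero    F b n = refl
  sumTo-⋆ (suc N) F b n = trans (⋆-distribʳ-⊕ (λ m → sumTo N (λ i → F i m)) (F (suc N)) b n)
                                (+-cong (sumTo-⋆ N F b n) refl)

  twist : Carrier → Seq → Seq
  twist u a n = pow u n * a n

  twist-cong : ∀ u {a b} → a ≐ b → twist u a ≐ twist u b
  twist-cong u a≐b n = *-cong refl (a≐b n)

  twist-⋆ : ∀ u a b → twist u (a ⋆ b) ≐ twist u a ⋆ twist u b
  twist-⋆ u a b n = trans (*-Σ-antidiag n _ _) (Σ-antidiag-cong n (λ i j i+j≡n → begin
    pow u n * (nat (binom i j) * (a i * b j))
      ≈⟨ *-cong (reflexive (≡.cong (pow u) (≡.sym i+j≡n))) refl ⟩
    pow u (i +ℕ j) * (nat (binom i j) * (a i * b j))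
      ≈⟨ *-cong (pow-+ u i j) refl ⟩
    pow u i * pow u j * (nat (binom i j) * (a i * b j))
      ≈⟨ solve 5 (λ p q X a b → (p :* q) :* (X :* (a :* b)) := X :* ((p :* a) :* (q :* b))) refl
                 (pow u i) (pow u j) (nat (binom i j)) (a i) (b j) ⟩
    nat (binom i j) * (pow u i * a i * (pow u j * b j))
      ∎))

  twist-· : ∀ u s a → twist u (s · a) ≐ s · twist u a
  twist-· u s a n = x*yz≈y*xz (pow u n) s (a n)

  δ : ℕ → Seq
  δ zero    zero    = 1#
  δ zero    (suc n) = 0#
  δ (suc k) zero    = 0#
  δ (suc k) (suc n) = δ k n

  ⋆-identityʳ : ∀ a → a ⋆ δ 0 ≐ a
  ⋆-identityʳ a zero    = trans (*-cong 1#-homo (*-identityʳ _)) (*-identityˡ _)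
  ⋆-identityʳ a (suc n) = begin
    (a ⋆ δ 0) (suc n)
      ≈⟨ Σ-antidiag-snoc n (λ i j → nat (binom i j) * (a i * δ 0 j)) ⟩
    Σ-antidiag n (λ i j → nat (binom i (suc j)) * (a i * 0#)) + nat 1 * (a (suc n) * 1#)
      ≈⟨ +-cong (Σ-antidiag-cong n (λ i j _ → trans (*-cong refl (zeroʳ _)) (zeroʳ _))) refl ⟩
    Σ-antidiag n (λ _ _ → 0#) + nat 1 * (a (suc n) * 1#)
      ≈⟨ +-cong (Σ-antidiag-zero n) (trans (*-cong 1#-homo (*-identityʳ _)) (*-identityˡ _)) ⟩
    0# + a (suc n)
      ≈⟨ +-identityˡ _ ⟩
    a (suc n)
      ∎

  exp : Carrier → Seq
  exp x = pow x

  twist-exp : ∀ u x → twist u (exp x) ≐ exp (u * x)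
  twist-exp u x n = sym (pow-* u x n)

  Σ-antidiag-pascal : ∀ n (h : ℕ → ℕ → Carrier) →
    Σ-antidiag (suc n) (λ i j → nat (binom i j) * h i j) ≈
    Σ-antidiag n (λ i j → nat (binom i j) * h (suc i) j) + Σ-antidiag n (λ i j → nat (binom i j) * h i (suc j))
  Σ-antidiag-pascal zero    h = +-comm _ _
  Σ-antidiag-pascal (suc n) h = begin
    h₀ + Σ-antidiag (suc n) (λ i j → nat (binom (suc i) j) * h (suc i) j)
      ≈⟨ +-cong refl (Σ-antidiag-snoc n (λ i j → nat (binom (suc i) j) * h (suc i) j)) ⟩
    h₀ + (Σ-antidiag n (λ i j → nat (binom i (suc j) +ℕ binom (suc i) j) * h (suc i) (suc j)) + hₙ)
      ≈⟨ +-cong refl (+-cong (trans (Σ-antidiag-cong n (λ i j _ →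
           trans (*-cong (nat-+ (binom i (suc j)) (binom (suc i) j)) refl) (distribʳ _ _ _))) (Σ-antidiag-+ n _ _)) refl) ⟩
    h₀ + ((X + Y) + hₙ)
      ≈⟨ solve 4 (λ h₀ X Y hₙ → h₀ :+ ((X :+ Y) :+ hₙ) := (X :+ hₙ) :+ (h₀ :+ Y)) refl h₀ X Y hₙ ⟩
    (X + hₙ) + (h₀ + Y)
      ≈⟨ +-cong (Σ-antidiag-snoc n (λ i j → nat (binom i j) * h (suc i) j)) refl ⟨
    Σ-antidiag (suc n) (λ i j → nat (binom i j) * h (suc i) j) + (h₀ + Y)
      ∎
    where
    h₀ hₙ X Y : Carrier
    h₀ = nat 1 * h 0 (suc (suc n))
    hₙ = nat 1 * h (suc (suc n)) 0
    X = Σ-antidiag n (λ i j → nat (binom i (suc j)) * h (suc i) (suc j))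
    Y = Σ-antidiag n (λ i j → nat (binom (suc i) j) * h (suc i) (suc j))

  exp-⋆ : ∀ x y → exp x ⋆ exp y ≐ exp (x + y)
  exp-⋆ x y zero    = trans (*-cong 1#-homo (*-identityˡ _)) (*-identityˡ _)
  exp-⋆ x y (suc n) = begin
    (exp x ⋆ exp y) (suc n)
      ≈⟨ Σ-antidiag-pascal n (λ i j → pow x i * pow y j) ⟩
    Σ-antidiag n (λ i j → nat (binom i j) * (x * pow x i * pow y j)) + Σ-antidiag n (λ i j → nat (binom i j) * (pow x i * (y * pow y j)))
      ≈⟨ +-cong (trans (Σ-antidiag-cong n (λ i j _ → pullˡ x (pow x i) (pow y j) (nat (binom i j)))) (sym (*-Σ-antidiag n x _)))
                (trans (Σ-antidiag-cong n (λ i j _ → pullʳ y (pow x i) (pow y j) (nat (binom i j)))) (sym (*-Σ-antidiag n y _))) ⟩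
    x * (exp x ⋆ exp y) n + y * (exp x ⋆ exp y) n
      ≈⟨ distribʳ _ _ _ ⟨
    (x + y) * (exp x ⋆ exp y) n
      ≈⟨ *-cong refl (exp-⋆ x y n) ⟩
    (x + y) * pow (x + y) n
      ∎
    where
    pullˡ : ∀ z a b X → X * (z * a * b) ≈ z * (X * (a * b))
    pullˡ = solve 4 (λ z a b X → X :* (z :* a :* b) := z :* (X :* (a :* b))) refl
    pullʳ : ∀ z a b X → X * (a * (z * b)) ≈ z * (X * (a * b))
    pullʳ = solve 4 (λ z a b X → X :* (a :* (z :* b)) := z :* (X :* (a :* b))) refl

  expm1 : Seq
  expm1 zero    = 0#
  expm1 (suc n) = 1#

  exp-1#≐expm1⊕δ0 : exp 1# ≐ expm1 ⊕ δ 0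
  exp-1#≐expm1⊕δ0 zero    = sym (+-identityˡ _)
  exp-1#≐expm1⊕δ0 (suc n) = trans (*-identityˡ _) (trans (pow-1# n) (sym (+-identityʳ _)))

  exp⋆expm1 : ∀ x n → (exp x ⋆ expm1) n + pow x n ≈ pow (x + 1#) n
  exp⋆expm1 x n = begin
    (exp x ⋆ expm1) n + pow x n              ≈⟨ +-cong (⋆-comm expm1 (exp x) n) (⋆-identityʳ (exp x) n) ⟨
    (expm1 ⋆ exp x) n + (exp x ⋆ δ 0) n      ≈⟨ +-cong refl (⋆-comm (exp x) (δ 0) n) ⟩
    (expm1 ⋆ exp x) n + (δ 0 ⋆ exp x) n      ≈⟨ ⋆-distribʳ-⊕ expm1 (δ 0) (exp x) n ⟨
    ((expm1 ⊕ δ 0) ⋆ exp x) n                ≈⟨ ⋆-cong exp-1#≐expm1⊕δ0 ≐.refl n ⟨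
    (exp 1# ⋆ exp x) n                       ≈⟨ exp-⋆ 1# x n ⟩
    pow (1# + x) n                           ≈⟨ pow-cong n (+-comm 1# x) ⟩
    pow (x + 1#) n                           ∎

  ⋆-expm1-suc : ∀ a n → (a ⋆ expm1) (suc n) ≈ sumTo n (λ k → nat (suc n C k) * a k)
  ⋆-expm1-suc a n = begin
    (a ⋆ expm1) (suc n)
      ≈⟨ Σ-antidiag-snoc n (λ i j → nat (binom i j) * (a i * expm1 j)) ⟩
    Σ-antidiag n (λ i j → nat (binom i (suc j)) * (a i * 1#)) + nat 1 * (a (suc n) * 0#)
      ≈⟨ +-cong (Σ-antidiag-cong n (λ i j _ → *-cong refl (*-identityʳ _))) (trans (*-cong refl (zeroʳ _)) (zeroʳ _)) ⟩
    Σ-antidiag n (λ i j → nat (binom i (suc j)) * a i) + 0#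
      ≈⟨ +-identityʳ _ ⟩
    Σ-antidiag n (λ i j → nat (binom i (suc j)) * a i)
      ≈⟨ sumTo≈Σ-antidiag n (λ i j → nat (binom i (suc j)) * a i) ⟨
    sumTo n (λ k → nat (binom k (suc (n ∸ k))) * a k)
      ≈⟨ sumTo-cong n (λ k k≤n → *-cong (reflexive (≡.cong nat (≡.sym (suc-C-binom k≤n)))) refl) ⟩
    sumTo n (λ k → nat (suc n C k) * a k)
      ∎
    where
    suc-C-binom : ∀ {k} → k ≤ n → suc n C k ≡ binom k (suc (n ∸ k))
    suc-C-binom {k} k≤n = C≡binom′ k (suc (n ∸ k)) (≡.trans (ℕ.+-suc k (n ∸ k)) (≡.cong suc (ℕ.m+[n∸m]≡n k≤n)))

  -- The coefficient of a ⋆ expm1 at n + 1 is a combination of a 0, …, a n in which a n has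
  -- weight n + 1, a unit of the ℚ-algebra; so a is recovered by induction.
  ⋆-expm1-cancel : ∀ {a b} → a ⋆ expm1 ≐ b ⋆ expm1 → a ≐ b
  ⋆-expm1-cancel {a} {b} a⋆≐b⋆ n = agree n n ℕ.≤-refl
    where
    weighted : ∀ n → sumTo n (λ k → nat (suc n C k) * a k) ≈ sumTo n (λ k → nat (suc n C k) * b k)
    weighted n = trans (sym (⋆-expm1-suc a n)) (trans (a⋆≐b⋆ (suc n)) (⋆-expm1-suc b n))
    leading : ∀ n {x y} → nat (suc n C n) * x ≈ nat (suc n C n) * y → x ≈ y
    leading n eq = nat-suc-cancelˡ n
      (trans (*-cong (reflexive (≡.cong nat (≡.sym (suc-C n)))) refl) (trans eq (*-cong (reflexive (≡.cong nat (suc-C n))) refl)))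
    agree : ∀ n k → k ≤ n → a k ≈ b k
    agree zero    zero    _  = leading 0 (weighted 0)
    agree (suc n) k       k≤ with ℕ.m≤n⇒m<n∨m≡n k≤
    ... | inj₁ k< = agree n k (ℕ.m<1+n⇒m≤n k<)
    ... | inj₂ ≡.refl = leading (suc n) (∙-cancelˡ _ _ _ (begin
      lower a + nat (suc (suc n) C suc n) * a (suc n)  ≈⟨ weighted (suc n) ⟩
      lower b + nat (suc (suc n) C suc n) * b (suc n)  ≈⟨ +-cong lower-agree refl ⟨
      lower a + nat (suc (suc n) C suc n) * b (suc n)  ∎))
      where
      lower : Seq → Carrier
      lower s = sumTo n (λ k → nat (suc (suc n) C k) * s k)
      lower-agree : lower a ≈ lower b
      lower-agree = sumTo-cong n (λ k k≤n → *-cong refl (agree n k k≤n))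

  -- Bernoulli numbers and polynomials

  β : Seq
  β k = ι (bernoulliNumber k)

  ι-sumℚ-singleton : ∀ q → ι (sumℚ [ q ]) ≈ ι q
  ι-sumℚ-singleton q = trans (+-homo _ _) (trans (+-cong refl 0#-homo) (+-identityʳ _))

  ι-sumℚ-++ : ∀ xs ys → ι (sumℚ (xs ++ ys)) ≈ ι (sumℚ xs) + ι (sumℚ ys)
  ι-sumℚ-++ []       ys = trans (sym (+-identityˡ _)) (+-cong (sym 0#-homo) refl)
  ι-sumℚ-++ (x ∷ xs) ys = begin
    ι (x ℚ.+ sumℚ (xs ++ ys))            ≈⟨ +-homo x _ ⟩
    ι x + ι (sumℚ (xs ++ ys))            ≈⟨ +-cong refl (ι-sumℚ-++ xs ys) ⟩
    ι x + (ι (sumℚ xs) + ι (sumℚ ys))    ≈⟨ +-assoc _ _ _ ⟨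
    (ι x + ι (sumℚ xs)) + ι (sumℚ ys)    ≈⟨ +-cong (+-homo x _) refl ⟨
    ι (x ℚ.+ sumℚ xs) + ι (sumℚ ys)      ∎

  ι-sumℚ-upTo : ∀ (h : ℕ → ℚ) m → ι (sumℚ (map h (upTo (suc m)))) ≈ sumTo m (λ k → ι (h k))
  ι-sumℚ-upTo h zero    = ι-sumℚ-singleton (h 0)
  ι-sumℚ-upTo h (suc m) = begin
    ι (sumℚ (map h (upTo (suc (suc m)))))
      ≈⟨ reflexive (≡.cong (λ ks → ι (sumℚ (map h ks))) (≡.sym (List.upTo-∷ʳ (suc m)))) ⟩
    ι (sumℚ (map h (upTo (suc m) ++ [ suc m ])))
      ≈⟨ reflexive (≡.cong (λ qs → ι (sumℚ qs)) (List.map-++ h (upTo (suc m)) [ suc m ])) ⟩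
    ι (sumℚ (map h (upTo (suc m)) ++ [ h (suc m) ]))
      ≈⟨ ι-sumℚ-++ (map h (upTo (suc m))) [ h (suc m) ] ⟩
    ι (sumℚ (map h (upTo (suc m)))) + ι (sumℚ [ h (suc m) ])
      ≈⟨ +-cong (ι-sumℚ-upTo h m) (ι-sumℚ-singleton (h (suc m))) ⟩
    sumTo m (λ k → ι (h k)) + ι (h (suc m))
      ∎

  β-suc : ∀ m → β (suc m) ≈ - (ι (+ 1 ℚ./ suc (suc m)) * sumTo m (λ k → nat (suc (suc m) C k) * β k))
  β-suc m = begin
    β (suc m)
      ≈⟨ reflexive (≡.cong ι (bernoulliNumber-suc m)) ⟩
    ι ((-[1+ 0 ] ℚ./ suc (suc m)) ℚ.* sumℚ (map weighted (upTo (suc m))))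
      ≈⟨ *-homo _ _ ⟩
    ι (-[1+ 0 ] ℚ./ suc (suc m)) * ι (sumℚ (map weighted (upTo (suc m))))
      ≈⟨ *-cong (-‿homo (+ 1 ℚ./ suc (suc m))) (trans (ι-sumℚ-upTo weighted m) (sumTo-cong m (λ k _ → *-homo _ _))) ⟩
    - ι (+ 1 ℚ./ suc (suc m)) * sumTo m (λ k → nat (suc (suc m) C k) * β k)
      ≈⟨ -‿distribˡ-* _ _ ⟨
    - (ι (+ 1 ℚ./ suc (suc m)) * sumTo m (λ k → nat (suc (suc m) C k) * β k))
      ∎
    where
    weighted : ℕ → ℚ
    weighted k = ℕ→ℚ (suc (suc m) C k) ℚ.* bernoulliNumber k

  bernoulli-recurrence : ∀ m → sumTo (suc m) (λ k → nat (suc (suc m) C k) * β k) ≈ 0#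
  bernoulli-recurrence m = begin
    s + nat (suc (suc m) C suc m) * β (suc m)  ≈⟨ +-cong refl (*-cong (reflexive (≡.cong nat (suc-C (suc m)))) (β-suc m)) ⟩
    s + nat (suc (suc m)) * - (r * s)          ≈⟨ +-cong refl (-‿distribʳ-* _ _) ⟨
    s + - (nat (suc (suc m)) * (r * s))        ≈⟨ +-cong refl (-‿cong (trans (x*yz≈y*xz _ _ _) (trans (sym (*-assoc _ _ _))
                                                    (trans (*-cong (1/n*n≈1 (suc (suc m))) refl) (*-identityˡ s))))) ⟩
    s + - s                                    ≈⟨ -‿inverseʳ s ⟩
    0#                                         ∎
    where
    s r : Carrier
    s = sumTo m (λ k → nat (suc (suc m) C k) * β k)
    r = ι (+ 1 ℚ./ suc (suc m))

  β⋆expm1≐δ₁ : β ⋆ expm1 ≐ δ 1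
  β⋆expm1≐δ₁ zero          = trans (*-cong refl (zeroʳ _)) (zeroʳ _)
  β⋆expm1≐δ₁ (suc zero)    = trans (⋆-expm1-suc β 0) (trans (*-cong 1#-homo 1#-homo) (*-identityˡ _))
  β⋆expm1≐δ₁ (suc (suc m)) = trans (⋆-expm1-suc β (suc m)) (bernoulli-recurrence m)

  bernoulliSeq : Carrier → Seq
  bernoulliSeq x n = B n x

  bernoulliSeq≐β⋆exp : ∀ x → bernoulliSeq x ≐ β ⋆ exp x
  bernoulliSeq≐β⋆exp x n = trans (sumTo≈Σ-antidiag n (λ k j → nat (n C k) * β k * pow x j))
    (Σ-antidiag-cong n (λ k j k+j≡n → trans (*-assoc _ _ _)
      (*-cong (reflexive (≡.cong nat (C≡binom′ k j k+j≡n))) refl)))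

  twist-bernoulliSeq : ∀ u x → twist u (bernoulliSeq x) ≐ twist u β ⋆ exp (u * x)
  twist-bernoulliSeq u x n = begin
    twist u (bernoulliSeq x) n        ≈⟨ twist-cong u (bernoulliSeq≐β⋆exp x) n ⟩
    twist u (β ⋆ exp x) n             ≈⟨ twist-⋆ u β (exp x) n ⟩
    (twist u β ⋆ twist u (exp x)) n   ≈⟨ ⋆-cong ≐.refl (twist-exp u x) n ⟩
    (twist u β ⋆ exp (u * x)) n       ∎

  -- Power sums and Raabe's multiplication formula

  powerSum : ℕ → Seq
  powerSum N m = nat (S m N)

  powerSum≐sumTo-exp : ∀ N → powerSum N ≐ (λ m → sumTo N (λ i → exp (nat i) m))
  powerSum≐sumTo-exp zero    m = nat-^ 0 m
  powerSum≐sumTo-exp (suc N) m = trans (nat-+ (S m N) (suc N ℕ.^ m)) (+-cong (powerSum≐sumTo-exp N m) (nat-^ (suc N) m))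

  powerSum⋆expm1 : ∀ N → powerSum N ⋆ expm1 ≐ twist (nat (suc N)) expm1
  powerSum⋆expm1 N zero    = trans (trans (*-cong refl (zeroʳ _)) (zeroʳ _)) (sym (zeroʳ _))
  powerSum⋆expm1 N (suc n) = begin
    (powerSum N ⋆ expm1) (suc n)
      ≈⟨ ⋆-cong (powerSum≐sumTo-exp N) ≐.refl (suc n) ⟩
    ((λ m → sumTo N (λ i → exp (nat i) m)) ⋆ expm1) (suc n)
      ≈⟨ sumTo-⋆ N (λ i → exp (nat i)) expm1 (suc n) ⟩
    sumTo N (λ i → (exp (nat i) ⋆ expm1) (suc n))
      ≈⟨ +-identityʳ _ ⟨
    sumTo N (λ i → (exp (nat i) ⋆ expm1) (suc n)) + 0#
      ≈⟨ +-cong refl (trans (*-cong 0#-homo refl) (zeroˡ _)) ⟨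
    sumTo N (λ i → (exp (nat i) ⋆ expm1) (suc n)) + pow (nat 0) (suc n)
      ≈⟨ sumTo-telescope N (λ i → trans (exp⋆expm1 (nat i) (suc n)) (pow-cong (suc n) (sym (nat-suc i)))) ⟩
    pow (nat (suc N)) (suc n)
      ≈⟨ *-identityʳ _ ⟨
    twist (nat (suc N)) expm1 (suc n)
      ∎

  twist-δ₁ : ∀ u → twist u (δ 1) ≐ u · δ 1
  twist-δ₁ u zero          = trans (zeroʳ _) (sym (zeroʳ _))
  twist-δ₁ u (suc zero)    = *-cong (*-identityʳ _) refl
  twist-δ₁ u (suc (suc n)) = trans (zeroʳ _) (sym (zeroʳ _))

  twist-β⋆powerSum : ∀ N → twist (nat (suc N)) β ⋆ powerSum N ≐ nat (suc N) · β
  twist-β⋆powerSum N = ⋆-expm1-cancel λ n → begin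
    (twist W β ⋆ powerSum N ⋆ expm1) n      ≈⟨ ⋆-assoc (twist W β) (powerSum N) expm1 n ⟩
    (twist W β ⋆ (powerSum N ⋆ expm1)) n    ≈⟨ ⋆-cong ≐.refl (powerSum⋆expm1 N) n ⟩
    (twist W β ⋆ twist W expm1) n           ≈⟨ twist-⋆ W β expm1 n ⟨
    twist W (β ⋆ expm1) n                   ≈⟨ twist-cong W β⋆expm1≐δ₁ n ⟩
    twist W (δ 1) n                         ≈⟨ twist-δ₁ W n ⟩
    (W · δ 1) n                             ≈⟨ ·-cong W β⋆expm1≐δ₁ n ⟨
    (W · (β ⋆ expm1)) n                     ≈⟨ ⋆-·ˡ W β expm1 n ⟨
    (W · β ⋆ expm1) n                       ∎
    where
    W : Carrier
    W = nat (suc N)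

  raabe : ∀ N y → twist (nat (suc N)) (bernoulliSeq y) ⋆ powerSum N ≐ nat (suc N) · bernoulliSeq (nat (suc N) * y)
  raabe N y n = begin
    (twist W (bernoulliSeq y) ⋆ powerSum N) n          ≈⟨ ⋆-cong (twist-bernoulliSeq W y) ≐.refl n ⟩
    (twist W β ⋆ exp (W * y) ⋆ powerSum N) n           ≈⟨ xy∙z≈xz∙y (twist W β) (exp (W * y)) (powerSum N) n ⟩
    (twist W β ⋆ powerSum N ⋆ exp (W * y)) n           ≈⟨ ⋆-cong (twist-β⋆powerSum N) ≐.refl n ⟩
    (W · β ⋆ exp (W * y)) n                            ≈⟨ ⋆-·ˡ W β (exp (W * y)) n ⟩
    (W · (β ⋆ exp (W * y))) n                          ≈⟨ ·-cong W (bernoulliSeq≐β⋆exp (W * y)) n ⟨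
    (W · bernoulliSeq (W * y)) n                       ∎
    where
    W : Carrier
    W = nat (suc N)

  twistedProduct : Carrier → Carrier → Carrier → Carrier → Seq
  twistedProduct u v x y = twist v (bernoulliSeq (u * x)) ⋆ twist u (bernoulliSeq (v * y))

  twistedProduct-comm : ∀ u v x y → twistedProduct u v x y ≐ twistedProduct v u x y
  twistedProduct-comm u v x y n = begin
    twistedProduct u v x y n
      ≈⟨ ⋆-cong (twist-bernoulliSeq v (u * x)) (twist-bernoulliSeq u (v * y)) n ⟩
    ((twist v β ⋆ exp (v * (u * x))) ⋆ (twist u β ⋆ exp (u * (v * y)))) n
      ≈⟨ ⋆-cong (⋆-comm (twist v β) _) ≐.refl n ⟩
    ((exp (v * (u * x)) ⋆ twist v β) ⋆ (twist u β ⋆ exp (u * (v * y)))) n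
      ≈⟨ interchange (exp (v * (u * x))) (twist v β) (twist u β) (exp (u * (v * y))) n ⟩
    ((exp (v * (u * x)) ⋆ twist u β) ⋆ (twist v β ⋆ exp (u * (v * y)))) n
      ≈⟨ ⋆-cong (≐.trans (⋆-comm _ (twist u β)) (⋆-cong ≐.refl (λ k → pow-cong k (x*yz≈y*xz v u x))))
                (⋆-cong ≐.refl (λ k → pow-cong k (x*yz≈y*xz u v y))) n ⟩
    ((twist u β ⋆ exp (u * (v * x))) ⋆ (twist v β ⋆ exp (v * (u * y)))) n
      ≈⟨ ⋆-cong (twist-bernoulliSeq u (v * x)) (twist-bernoulliSeq v (u * y)) n ⟨
    twistedProduct v u x y n
      ∎

  binomialSum≈twistedProduct : ∀ u v x y n →
    sumTo n (λ k → nat (n C k) * B k (u * x) * B (n ∸ k) (v * y) * pow u (n ∸ k) * pow v k)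
    ≈ twistedProduct u v x y n
  binomialSum≈twistedProduct u v x y n =
    trans (sumTo≈Σ-antidiag n (λ k j → nat (n C k) * B k (u * x) * B j (v * y) * pow u j * pow v k))
          (Σ-antidiag-cong n (λ k j k+j≡n → trans
            (solve 5 (λ X P Q a b → X :* P :* Q :* a :* b := X :* ((b :* P) :* (a :* Q))) refl
               (nat (n C k)) (B k (u * x)) (B j (v * y)) (pow u j) (pow v k))
            (*-cong (reflexive (≡.cong nat (C≡binom′ k j k+j≡n))) refl)))

  sumTriple≈⋆⋆ : ∀ n T s a b d → (∀ k l m → T k l m ≈ s * (nat (multinomial k l m) * (a k * (b l * d m)))) →
                 sumTriple n T ≈ s * (a ⋆ (b ⋆ d)) n
  sumTriple≈⋆⋆ n T s a b d T≈ = begin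
    sumTriple n T
      ≈⟨ sumTo≈Σ-antidiag n (λ k r → sumTo r (λ l → T k l (r ∸ l))) ⟩
    Σ-antidiag n (λ k r → sumTo r (λ l → T k l (r ∸ l)))
      ≈⟨ Σ-antidiag-cong n (λ k r _ → trans (sumTo≈Σ-antidiag r (T k)) (Σ-antidiag-cong r (λ l m _ → T≈ k l m))) ⟩
    Σ-antidiag n (λ k r → Σ-antidiag r (λ l m → s * (nat (multinomial k l m) * (a k * (b l * d m)))))
      ≈⟨ Σ-antidiag-cong n (λ k r _ → *-Σ-antidiag r s _) ⟨
    Σ-antidiag n (λ k r → s * Σ-antidiag r (λ l m → nat (multinomial k l m) * (a k * (b l * d m))))
      ≈⟨ *-Σ-antidiag n s _ ⟨
    s * Σ-antidiag n (λ k r → Σ-antidiag r (λ l m → nat (multinomial k l m) * (a k * (b l * d m))))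
      ≈⟨ *-cong refl (Σ-antidiag-cong n (λ k r _ → Σ-antidiag-cong r (λ l m _ →
           *-cong (reflexive (≡.cong nat (multinomial≡binom*binom k l m))) refl))) ⟩
    s * Σ-antidiag n (λ k r → Σ-antidiag r (λ l m → nat (binom k (l +ℕ m) ℕ.* binom l m) * (a k * (b l * d m))))
      ≈⟨ *-cong refl (⋆-⋆-expand a b d n) ⟨
    s * (a ⋆ (b ⋆ d)) n
      ∎

  powℤ-cancel : ∀ N z → ι (powℤ (suc N) -[1+ 0 ]) * (nat (suc N) * z) ≈ z
  powℤ-cancel N z = trans (sym (*-assoc _ _ _)) (trans (*-cong W⁻¹*W≈1 refl) (*-identityˡ z))
    where
    W⁻¹*W≈1 : ι (powℤ (suc N) -[1+ 0 ]) * nat (suc N) ≈ 1#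
    W⁻¹*W≈1 = trans (*-cong refl (reflexive (≡.cong nat (≡.sym (ℕ.*-identityʳ (suc N)))))) (1/n*n≈1 (suc N ℕ.^ 1))

  powℤ-⊖1 : ∀ N j → ι (powℤ (suc N) (j ⊖ 1)) ≈ ι (powℤ (suc N) -[1+ 0 ]) * pow (nat (suc N)) j
  powℤ-⊖1 N zero    = sym (*-identityʳ _)
  powℤ-⊖1 N (suc j) = trans (nat-^ (suc N) j) (sym (powℤ-cancel N (pow (nat (suc N)) j)))

  twist-raabe : ∀ N v y → twist v (twist (nat (suc N)) (bernoulliSeq y)) ⋆ twist v (powerSum N)
                          ≐ nat (suc N) · twist v (bernoulliSeq (nat (suc N) * y))
  twist-raabe N v y n = begin
    (twist v (twist W (bernoulliSeq y)) ⋆ twist v (powerSum N)) n  ≈⟨ twist-⋆ v (twist W (bernoulliSeq y)) (powerSum N) n ⟨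
    twist v (twist W (bernoulliSeq y) ⋆ powerSum N) n              ≈⟨ twist-cong v (raabe N y) n ⟩
    twist v (W · bernoulliSeq (W * y)) n                           ≈⟨ twist-· v W (bernoulliSeq (W * y)) n ⟩
    (W · twist v (bernoulliSeq (W * y))) n                         ∎
    where
    W : Carrier
    W = nat (suc N)

  raabeSumˡ≈twistedProduct : ∀ N v y₁ y₂ n →
    sumTriple n (λ k l m → nat (multinomial k l m) * B k y₁ * B l (v * y₂)
                           * nat (S m N) * pow v (k +ℕ m) * ι (powℤ (suc N) ((k +ℕ l) ⊖ 1)))
    ≈ twistedProduct (nat (suc N)) v y₁ y₂ n
  raabeSumˡ≈twistedProduct N v y₁ y₂ n = trans
    (sumTriple≈⋆⋆ n _ W⁻¹ a b d (λ k l m → trans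
      (*-cong (*-cong refl (pow-+ v k m)) (trans (powℤ-⊖1 N (k +ℕ l)) (*-cong refl (pow-+ W k l))))
      (solve 9 (λ M Bk Bl s vk vm w wk wl →
         M :* Bk :* Bl :* s :* (vk :* vm) :* (w :* (wk :* wl))
           := w :* (M :* ((vk :* (wk :* Bk)) :* ((wl :* Bl) :* (vm :* s))))) refl
         (nat (multinomial k l m)) (B k y₁) (B l (v * y₂)) (nat (S m N)) (pow v k) (pow v m) W⁻¹ (pow W k) (pow W l))))
    (begin
      W⁻¹ * (a ⋆ (b ⋆ d)) n                                 ≈⟨ *-cong refl (x∙yz≈xz∙y a b d n) ⟩
      W⁻¹ * (a ⋆ d ⋆ b) n                                   ≈⟨ *-cong refl (⋆-cong (twist-raabe N v y₁) ≐.refl n) ⟩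
      W⁻¹ * (W · twist v (bernoulliSeq (W * y₁)) ⋆ b) n     ≈⟨ *-cong refl (⋆-·ˡ W _ b n) ⟩
      W⁻¹ * (W * (twist v (bernoulliSeq (W * y₁)) ⋆ b) n)   ≈⟨ powℤ-cancel N _ ⟩
      twistedProduct W v y₁ y₂ n                            ∎)
    where
    W W⁻¹ : Carrier
    W   = nat (suc N)
    W⁻¹ = ι (powℤ (suc N) -[1+ 0 ])
    a b d : Seq
    a   = twist v (twist W (bernoulliSeq y₁))
    b   = twist W (bernoulliSeq (v * y₂))
    d   = twist v (powerSum N)

  raabeSumʳ≈twistedProduct : ∀ N v y₁ y₂ n →
    sumTriple n (λ k l m → nat (multinomial k l m) * B k (v * y₁) * B l y₂
                           * nat (S m N) * pow v (l +ℕ m) * ι (powℤ (suc N) ((k +ℕ l) ⊖ 1)))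
    ≈ twistedProduct v (nat (suc N)) y₁ y₂ n
  raabeSumʳ≈twistedProduct N v y₁ y₂ n = trans
    (sumTriple≈⋆⋆ n _ W⁻¹ a b d (λ k l m → trans
      (*-cong (*-cong refl (pow-+ v l m)) (trans (powℤ-⊖1 N (k +ℕ l)) (*-cong refl (pow-+ W k l))))
      (solve 9 (λ M Bk Bl s vl vm w wk wl →
         M :* Bk :* Bl :* s :* (vl :* vm) :* (w :* (wk :* wl))
           := w :* (M :* ((wk :* Bk) :* ((vl :* (wl :* Bl)) :* (vm :* s))))) refl
         (nat (multinomial k l m)) (B k (v * y₁)) (B l y₂) (nat (S m N)) (pow v l) (pow v m) W⁻¹ (pow W k) (pow W l))))
    (begin
      W⁻¹ * (a ⋆ (b ⋆ d)) n                                 ≈⟨ *-cong refl (⋆-cong ≐.refl (twist-raabe N v y₂) n) ⟩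
      W⁻¹ * (a ⋆ (W · twist v (bernoulliSeq (W * y₂)))) n   ≈⟨ *-cong refl (⋆-·ʳ W a _ n) ⟩
      W⁻¹ * (W * (a ⋆ twist v (bernoulliSeq (W * y₂))) n)   ≈⟨ powℤ-cancel N _ ⟩
      twistedProduct v W y₁ y₂ n                            ∎)
    where
    W W⁻¹ : Carrier
    W   = nat (suc N)
    W⁻¹ = ι (powℤ (suc N) -[1+ 0 ])
    a b d : Seq
    a   = twist W (bernoulliSeq (v * y₁))
    b   = twist v (twist W (bernoulliSeq y₂))
    d   = twist v (powerSum N)

corollary3 : ∀ {c ℓ} (A : QAlgebra c ℓ) (p : ℕ) → Prime p →
  (w₁ w₂ : ℕ) → .{{_ : NonZero w₁}} → .{{_ : NonZero w₂}} →
  (y₁ y₂ : QAlgebra.Carrier A) (n : ℕ) →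
  let open QAlgebra A
      open Over A
      W₁ = nat w₁
      W₂ = nat w₂
      E₁ = sumTo n (λ k → nat (n C k) * B k (W₁ * y₁) * B (n ∸ k) (W₂ * y₂)
                            * pow W₁ (n ∸ k) * pow W₂ k)
      E₂ = sumTo n (λ k → nat (n C k) * B k (W₂ * y₁) * B (n ∸ k) (W₁ * y₂)
                            * pow W₂ (n ∸ k) * pow W₁ k)
      E₃ = sumTriple n (λ k l m → nat (multinomial k l m) * B k y₁ * B l (W₂ * y₂)
                            * nat (S m (w₁ ∸ 1)) * pow W₂ (k +ℕ m) * ι (powℤ w₁ ((k +ℕ l) ⊖ 1)))
      E₄ = sumTriple n (λ k l m → nat (multinomial k l m) * B k (W₂ * y₁) * B l y₂
                            * nat (S m (w₁ ∸ 1)) * pow W₂ (l +ℕ m) * ι (powℤ w₁ ((k +ℕ l) ⊖ 1)))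
      E₅ = sumTriple n (λ k l m → nat (multinomial k l m) * B k y₁ * B l (W₁ * y₂)
                            * nat (S m (w₂ ∸ 1)) * pow W₁ (k +ℕ m) * ι (powℤ w₂ ((k +ℕ l) ⊖ 1)))
      E₆ = sumTriple n (λ k l m → nat (multinomial k l m) * B k (W₁ * y₁) * B l y₂
                            * nat (S m (w₂ ∸ 1)) * pow W₁ (l +ℕ m) * ι (powℤ w₂ ((k +ℕ l) ⊖ 1)))
  in (E₁ ≈ E₂) × (E₂ ≈ E₃) × (E₃ ≈ E₄) × (E₄ ≈ E₅) × (E₅ ≈ E₆)
corollary3 A p _ zero    w₂      {{w₁≢0}} y₁ y₂ n = ⊥-elim (ℕ.≢-nonZero⁻¹ zero {{w₁≢0}} ≡.refl)
corollary3 A p _ (suc a) zero    {{_}} {{w₂≢0}} y₁ y₂ n = ⊥-elim (ℕ.≢-nonZero⁻¹ zero {{w₂≢0}} ≡.refl)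
corollary3 A p _ (suc a) (suc b) y₁ y₂ n =
    trans E₁≈P₁₂ (trans P₁₂≈P₂₁ (sym E₂≈P₂₁))
  , trans E₂≈P₂₁ (trans (sym P₁₂≈P₂₁) (sym E₃≈P₁₂))
  , trans E₃≈P₁₂ (trans P₁₂≈P₂₁ (sym E₄≈P₂₁))
  , trans E₄≈P₂₁ (sym E₅≈P₂₁)
  , trans E₅≈P₂₁ (trans (sym P₁₂≈P₂₁) (sym E₆≈P₁₂))
  where
  open QAlgebra A using (Carrier; _≈_; trans; sym)
  open Over A using (nat)
  open ExponentialGeneratingFunctions A
  W₁ W₂ : Carrier
  W₁ = nat (suc a)
  W₂ = nat (suc b)
  P₁₂≈P₂₁ : twistedProduct W₁ W₂ y₁ y₂ n ≈ twistedProduct W₂ W₁ y₁ y₂ n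
  P₁₂≈P₂₁ = twistedProduct-comm W₁ W₂ y₁ y₂ n
  E₁≈P₁₂ = binomialSum≈twistedProduct W₁ W₂ y₁ y₂ n
  E₂≈P₂₁ = binomialSum≈twistedProduct W₂ W₁ y₁ y₂ n
  E₃≈P₁₂ = raabeSumˡ≈twistedProduct a W₂ y₁ y₂ n
  E₄≈P₂₁ = raabeSumʳ≈twistedProduct a W₂ y₁ y₂ n
  E₅≈P₂₁ = raabeSumˡ≈twistedProduct b W₁ y₁ y₂ n
  E₆≈P₁₂ = raabeSumʳ≈twistedProduct b W₁ y₁ y₂ n
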